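{- Let $\vec G$ be a $C^\circlearrowright_{3}$-free orientation of a graph $G$ on $n$ vertices. There exists a set $S\subset E(\vec G)$ with $|S|\le 2n\cdot\alpha(G)$ such that $\vec G$ is the unique $C^\circlearrowright_3$-free orientation of $G$ containing $S$.
   Context: $C^\circlearrowright_3$ is the directed triangle; an orientation is $C^\circlearrowright_3$-free if it contains no directed triangle. $\alpha(G)$ is the independence number of $G$. An orientation of $G$ "contains $S$" if each directed edge in $S$ appears with that direction. -}

module Defs where

open import Data.Nat using (ℕ; _≤_; _*_)
open import Data.Bool using (Bool; true; false)
open import Data.Fin using (Fin)
open import Data.Fin.Subset using (Subset; _∈_; ∣_∣)
open import Data.Product using (Σ; ∃; _×_; _,_)
open import Data.Sum using (_⊎_)
open import Data.List using (List)
open import Data.List.Membership.Propositional renaming (_∈_ to _∈ₗ_)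
open import Relation.Binary.PropositionalEquality using (_≡_)
open import Relation.Nullary using (¬_)

record Graph (n : ℕ) : Set where
  field
    adj    : Fin n → Fin n → Bool
    sym    : ∀ u v → adj u v ≡ adj v u
    irrefl : ∀ u → adj u u ≡ false
open Graph public

-- A directed relation on the vertices: o u v ≡ true means the arc u → v.
Digraph : ℕ → Set
Digraph n = Fin n → Fin n → Bool

record IsOrientation {n : ℕ} (G : Graph n) (o : Digraph n) : Set where
  field
    arc⇒edge  : ∀ u v → o u v ≡ true → adj G u v ≡ true
    edge⇒arc  : ∀ u v → adj G u v ≡ true → (o u v ≡ true) ⊎ (o v u ≡ true)
    antisym   : ∀ u v → o u v ≡ true → ¬ (o v u ≡ true)

HasDirectedTriangle : {n : ℕ} → Digraph n → Set
HasDirectedTriangle {n} o =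
  Σ (Fin n) λ u → Σ (Fin n) λ v → Σ (Fin n) λ w →
    (o u v ≡ true) × (o v w ≡ true) × (o w u ≡ true)

C3Free : {n : ℕ} → Digraph n → Set
C3Free o = ¬ HasDirectedTriangle o

IsC3FreeOrientation : {n : ℕ} → Graph n → Digraph n → Set
IsC3FreeOrientation G o = IsOrientation G o × C3Free o

Contains : {n : ℕ} → Digraph n → List (Fin n × Fin n) → Set
Contains o S = ∀ {u v} → (u , v) ∈ₗ S → o u v ≡ true

Independent : {n : ℕ} → Graph n → Subset n → Set
Independent G I = ∀ u v → u ∈ I → v ∈ I → adj G u v ≡ false

IsIndependenceNumber : {n : ℕ} → Graph n → ℕ → Set
IsIndependenceNumber {n} G a =
  (Σ (Subset n) λ I → Independent G I × ∣ I ∣ ≡ a)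
  × (∀ (I : Subset n) → Independent G I → ∣ I ∣ ≤ a)

-- For a vertex u, let X⁺(u) be the out-neighbours of u of smaller index. Greedily, one finds an
-- independent set R⁺(u) ⊆ X⁺(u) from which every vertex of X⁺(u) is reached by a directed path
-- inside X⁺(u); symmetrically R⁻(u) for the in-neighbours. The seeds are the arcs u → r (r ∈ R⁺(u))
-- and r → u (r ∈ R⁻(u)): at most 2α per vertex. Let o′ be a C3-free orientation containing them.
-- By induction on the larger index, o′ agrees with o on all arcs between vertices below u. Walking
-- along a path r → … → x → w inside X⁺(u), if o′ has u → x and x → w, then u → w is forced, since
-- w → u would close a directed triangle. So o′ contains every arc of o, hence equals o.
module Submission where

open import Defs
open import Data.Nat using (ℕ; _≤_; _*_)
open import Data.Fin using (Fin)
open import Data.Product using (Σ; _×_)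
open import Data.List using (List; length)
open import Data.List.Relation.Unary.Unique.Propositional using (Unique)
open import Relation.Binary.PropositionalEquality using (_≡_)

open import Data.Bool using (Bool; true; false; _∧_; _∨_; not) renaming (_≟_ to _≟ᵇ_)
open import Data.Bool.Properties using (T-≡; ∧-conicalˡ; ∧-conicalʳ; ∨-zeroʳ; not-injective)
open import Data.Empty using (⊥-elim)
open import Data.Fin using (toℕ; _≟_)
open import Data.Fin.Properties using (toℕ-injective; toℕ<n; any?)
open import Data.Fin.Subset using (∣_∣) renaming (_∈_ to _∈ₛ_)
open import Data.List using ([]; _∷_; _++_; map; filterᵇ; tabulate; allFin; cartesianProduct)
open import Data.List.Properties using (length-++; length-map; length-tabulate; filter-++)
open import Data.List.Membership.Propositional using () renaming (_∈_ to _∈ₗ_)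
open import Data.List.Membership.Propositional.Properties
  using (∈-filter⁺; ∈-filter⁻; ∈-allFin; ∈-cartesianProduct⁺; ∈-map⁺; ∈-map⁻; ∈-++⁺ˡ; ∈-++⁺ʳ; ∈-++⁻)
open import Data.List.Relation.Unary.Any using (here; there)
import Data.List.Relation.Unary.Unique.Propositional.Properties as Unique
open import Data.Nat using (zero; suc; _+_; _<_; _<ᵇ_; z≤n)
open import Data.Nat.Properties
  using (<ᵇ⇒<; <⇒<ᵇ; <-asym; m<1+n⇒m<n∨m≡n; +-mono-≤; m≤m+n; *-assoc; module ≤-Reasoning)
open import Data.Product using (_,_; proj₁; proj₂; swap; uncurry)
open import Data.Sum using (_⊎_; inj₁; inj₂)
import Data.Sum as Sum
import Data.Vec as Vec
open import Data.Vec.Properties using (lookup∘tabulate; []=⇒lookup)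
open import Function using (_∘_)
open import Function.Bundles using (Equivalence)
open import Relation.Binary.PropositionalEquality using (refl; cong; subst)
import Relation.Binary.PropositionalEquality as ≡
open import Relation.Nullary using (¬_; yes; no; does; _×-dec_; contradiction)
open import Relation.Nullary.Decidable using (T?; dec-true)

open Equivalence

module _ {n : ℕ} (p : Digraph n) (X : Fin n → Bool) where

  data Reachable (R : Fin n → Bool) : Fin n → Set where
    root : ∀ {r} → R r ≡ true → Reachable R r
    step : ∀ {x w} → Reachable R x → X x ≡ true → X w ≡ true → p x w ≡ true → Reachable R w

  reachable-rebase : ∀ {R R′ w} → (∀ {r} → R r ≡ true → Reachable R′ r) →
    Reachable R w → Reachable R′ w
  reachable-rebase R⇝R′ (root Rw)          = R⇝R′ Rw
  reachable-rebase R⇝R′ (step r Xx Xw pxw) = step (reachable-rebase R⇝R′ r) Xx Xw pxw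

reachable⇒arc : ∀ {n} {p q : Digraph n} {X R : Fin n → Bool} {v} →
  (∀ r → R r ≡ true → q v r ≡ true) →
  (∀ x w → X x ≡ true → X w ≡ true → p x w ≡ true → q x w ≡ true) →
  (∀ w → X w ≡ true → (q v w ≡ true) ⊎ (q w v ≡ true)) →
  C3Free q →
  ∀ {w} → Reachable p X R w → q v w ≡ true
reachable⇒arc roots⇒q _ _ _ (root Rw) = roots⇒q _ Rw
reachable⇒arc {v = v} roots⇒q p⇒q total c3 (step {x} {w} r Xx Xw pxw) with total w Xw
... | inj₁ qvw = qvw
... | inj₂ qwv = ⊥-elim (c3 (v , x , w , reachable⇒arc roots⇒q p⇒q total c3 r , p⇒q x w Xx Xw pxw , qwv))

module _ {n : ℕ} (G : Graph n) (p : Digraph n) (X : Fin n → Bool) where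

  record RootedCover (l : List (Fin n)) : Set where
    field
      roots             : Fin n → Bool
      roots⊆X           : ∀ r → roots r ≡ true → X r ≡ true
      roots-independent : ∀ u v → roots u ≡ true → roots v ≡ true → adj G u v ≡ false
      reaches           : ∀ w → w ∈ₗ l → X w ≡ true → Reachable p X roots w
  open RootedCover

  cover-∷ : ∀ {u l} (c : RootedCover l) → (X u ≡ true → Reachable p X (roots c) u) →
    RootedCover (u ∷ l)
  cover-∷ c reach-u = record
    { roots             = roots c
    ; roots⊆X           = roots⊆X c
    ; roots-independent = roots-independent c
    ; reaches           = λ
      { w (here refl) → reach-u
      ; w (there w∈l) → reaches c w w∈l }
    }

  module _ (edge⇒arc : ∀ u v → adj G u v ≡ true → (p u v ≡ true) ⊎ (p v u ≡ true)) where

    -- u becomes a root and evicts its neighbours among the old roots; as no old root has an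
    -- arc into u, each evicted root is an out-neighbour of u and stays reachable.
    add-root : ∀ {u l} (c : RootedCover l) → X u ≡ true →
      (∀ r → roots c r ≡ true → ¬ p r u ≡ true) → RootedCover (u ∷ l)
    add-root {u} c Xu unreached = record
      { roots             = R′
      ; roots⊆X           = R′⊆X
      ; roots-independent = R′-independent
      ; reaches           = λ
        { w (here refl) _  → root R′-u
        ; w (there w∈l) Xw → reachable-rebase p X old-root-reachable (reaches c w w∈l Xw) }
      }
      where
        R′ : Fin n → Bool
        R′ w = does (w ≟ u) ∨ (roots c w ∧ not (adj G u w))

        R′-u : R′ u ≡ true
        R′-u = cong (_∨ (roots c u ∧ not (adj G u u))) (dec-true (u ≟ u) refl)

        R′-old : ∀ {r} → roots c r ≡ true → adj G u r ≡ false → R′ r ≡ true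
        R′-old {r} rr ur rewrite rr | ur = ∨-zeroʳ (does (r ≟ u))

        R′-elim : ∀ w → R′ w ≡ true → (w ≡ u) ⊎ (roots c w ≡ true × adj G u w ≡ false)
        R′-elim w R′w with w ≟ u
        ... | yes w≡u = inj₁ w≡u
        ... | no _    = inj₂ (∧-conicalˡ _ _ R′w , not-injective {y = false} (∧-conicalʳ _ _ R′w))

        R′⊆X : ∀ r → R′ r ≡ true → X r ≡ true
        R′⊆X r R′r with R′-elim r R′r
        ... | inj₁ refl     = Xu
        ... | inj₂ (rr , _) = roots⊆X c r rr

        R′-independent : ∀ a b → R′ a ≡ true → R′ b ≡ true → adj G a b ≡ false
        R′-independent a b R′a R′b with R′-elim a R′a | R′-elim b R′b
        ... | inj₁ refl      | inj₁ refl      = irrefl G a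
        ... | inj₁ refl      | inj₂ (_ , ub)  = ub
        ... | inj₂ (_ , ua)  | inj₁ refl      = ≡.trans (sym G a u) ua
        ... | inj₂ (ra , _)  | inj₂ (rb , _)  = roots-independent c a b ra rb

        old-root-reachable : ∀ {r} → roots c r ≡ true → Reachable p X R′ r
        old-root-reachable {r} rr with adj G u r in ur
        ... | false = root (R′-old rr ur)
        ... | true with edge⇒arc u r ur
        ...   | inj₁ pur = step (root R′-u) Xu (roots⊆X c r rr) pur
        ...   | inj₂ pru = ⊥-elim (unreached r rr pru)

    rootedCover : ∀ l → RootedCover l
    rootedCover [] = record
      { roots = λ _ → false ; roots⊆X = λ _ () ; roots-independent = λ _ _ () ; reaches = λ _ () }
    rootedCover (u ∷ l) with rootedCover l | X u in Xu
    ... | c | false = cover-∷ c (λ Xu′ → contradiction (≡.trans (≡.sym Xu′) Xu) λ ())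
    ... | c | true with any? (λ r → (roots c r ≟ᵇ true) ×-dec (p r u ≟ᵇ true))
    ...   | yes (r , rr , pru) = cover-∷ c (λ _ → step (root rr) (roots⊆X c r rr) Xu pru)
    ...   | no none            = add-root c Xu (λ r rr pru → none (r , rr , pru))

length-filterᵇ-tabulate : ∀ {n m} (f : Fin n → Bool) (g : Fin m → Fin n) →
  length (filterᵇ f (tabulate g)) ≡ ∣ Vec.tabulate (f ∘ g) ∣
length-filterᵇ-tabulate {m = zero}  f g = refl
length-filterᵇ-tabulate {m = suc m} f g with f (g Fin.zero)
... | true  = cong suc (length-filterᵇ-tabulate f (g ∘ Fin.suc))
... | false = length-filterᵇ-tabulate f (g ∘ Fin.suc)

length-filterᵇ-independent≤ : ∀ {n a} (G : Graph n) → IsIndependenceNumber G a →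
  (f : Fin n → Bool) → (∀ u v → f u ≡ true → f v ≡ true → adj G u v ≡ false) →
  length (filterᵇ f (allFin n)) ≤ a
length-filterᵇ-independent≤ {a = a} G (_ , maximal) f independent =
  subst (_≤ a) (≡.sym (length-filterᵇ-tabulate f (λ i → i)))
    (maximal (Vec.tabulate f) λ u v u∈ v∈ → independent u v (member u u∈) (member v v∈))
  where
    member : ∀ u → u ∈ₛ Vec.tabulate f → f u ≡ true
    member u u∈ = ≡.trans (≡.sym (lookup∘tabulate f u)) ([]=⇒lookup u∈)

length-filterᵇ-map : ∀ {A B : Set} (P : B → Bool) (f : A → B) (xs : List A) →
  length (filterᵇ P (map f xs)) ≡ length (filterᵇ (P ∘ f) xs)
length-filterᵇ-map P f []       = refl
length-filterᵇ-map P f (x ∷ xs) with P (f x)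
... | true  = cong suc (length-filterᵇ-map P f xs)
... | false = length-filterᵇ-map P f xs

length-filterᵇ-cartesianProduct≤ : ∀ {A B : Set} {a} (P : A × B → Bool) (xs : List A) (ys : List B) →
  (∀ x → length (filterᵇ (λ y → P (x , y)) ys) ≤ a) →
  length (filterᵇ P (cartesianProduct xs ys)) ≤ length xs * a
length-filterᵇ-cartesianProduct≤ P []       ys bound = z≤n
length-filterᵇ-cartesianProduct≤ {a = a} P (x ∷ xs) ys bound = begin
  length (filterᵇ P (map (x ,_) ys ++ rest))
    ≡⟨ cong length (filter-++ (T? ∘ P) (map (x ,_) ys) rest) ⟩
  length (filterᵇ P (map (x ,_) ys) ++ filterᵇ P rest)
    ≡⟨ length-++ (filterᵇ P (map (x ,_) ys)) ⟩
  length (filterᵇ P (map (x ,_) ys)) + length (filterᵇ P rest)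
    ≡⟨ cong (_+ length (filterᵇ P rest)) (length-filterᵇ-map P (x ,_) ys) ⟩
  length (filterᵇ (λ y → P (x , y)) ys) + length (filterᵇ P rest)
    ≤⟨ +-mono-≤ (bound x) (length-filterᵇ-cartesianProduct≤ P xs ys bound) ⟩
  a + length xs * a ∎
  where
    open ≤-Reasoning
    rest = cartesianProduct xs ys

reverse : ∀ {n} → Digraph n → Digraph n
reverse o u v = o v u

reverse-C3Free : ∀ {n} {o : Digraph n} → C3Free o → C3Free (reverse o)
reverse-C3Free c3 (u , v , w , ovu , owv , ouw) = c3 (u , w , v , ouw , owv , ovu)

module _ {n : ℕ} {G : Graph n} where

  reverse-isOrientation : ∀ {o} → IsOrientation G o → IsOrientation G (reverse o)
  reverse-isOrientation ori = record
    { arc⇒edge = λ u v ovu → ≡.trans (sym G u v) (arc⇒edge v u ovu)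
    ; edge⇒arc = λ u v uv → Sum.swap (edge⇒arc u v uv)
    ; antisym  = λ u v → antisym v u
    }
    where open IsOrientation ori

  orientation-irreflexive : ∀ {o} → IsOrientation G o → ∀ u → ¬ o u u ≡ true
  orientation-irreflexive ori u ouu with () ← ≡.trans (≡.sym (IsOrientation.arc⇒edge ori u u ouu)) (irrefl G u)

  orientation-⊆⇒≡ : ∀ {o o′} → IsOrientation G o → IsOrientation G o′ →
    (∀ u v → o u v ≡ true → o′ u v ≡ true) → ∀ u v → o′ u v ≡ o u v
  orientation-⊆⇒≡ {o} {o′} ori ori′ o⊆o′ u v with o u v in ouv
  ... | true = o⊆o′ u v ouv
  ... | false with o′ u v in o′uv
  ...   | false = refl
  ...   | true with IsOrientation.edge⇒arc ori u v (IsOrientation.arc⇒edge ori′ u v o′uv)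
  ...     | inj₁ ouv′ = contradiction (≡.trans (≡.sym ouv′) ouv) λ ()
  ...     | inj₂ ovu  = ⊥-elim (IsOrientation.antisym ori′ u v o′uv (o⊆o′ v u ovu))

module Seeds {n : ℕ} (G : Graph n) where

  open RootedCover

  lowerOut : Digraph n → Fin n → Fin n → Bool
  lowerOut o u v = (toℕ v <ᵇ toℕ u) ∧ o u v

  lowerOut⁻ : ∀ o u v → lowerOut o u v ≡ true → toℕ v < toℕ u × o u v ≡ true
  lowerOut⁻ o u v h = <ᵇ⇒< (toℕ v) (toℕ u) (from T-≡ (∧-conicalˡ _ _ h)) , ∧-conicalʳ _ _ h

  lowerOut⁺ : ∀ {o u v} → toℕ v < toℕ u → o u v ≡ true → lowerOut o u v ≡ true
  lowerOut⁺ v<u ouv rewrite to T-≡ (<⇒<ᵇ v<u) = ouv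

  lowerCover : ∀ {o} → IsOrientation G o → (u : Fin n) → RootedCover G o (lowerOut o u) (allFin n)
  lowerCover {o} ori u = rootedCover G o (lowerOut o u) (IsOrientation.edge⇒arc ori) (allFin n)

  lowerRoots : ∀ {o} → IsOrientation G o → Fin n → Fin n → Bool
  lowerRoots ori u = roots (lowerCover ori u)

  allPairs : List (Fin n × Fin n)
  allPairs = cartesianProduct (allFin n) (allFin n)

  outSeeds : ∀ {o} → IsOrientation G o → List (Fin n × Fin n)
  outSeeds ori = filterᵇ (uncurry (lowerRoots ori)) allPairs

  ∈-outSeeds⁺ : ∀ {o} (ori : IsOrientation G o) {u r} → lowerRoots ori u r ≡ true →
    (u , r) ∈ₗ outSeeds ori
  ∈-outSeeds⁺ ori {u} {r} ur =
    ∈-filter⁺ (T? ∘ uncurry (lowerRoots ori)) (∈-cartesianProduct⁺ (∈-allFin u) (∈-allFin r)) (from T-≡ ur)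

  ∈-outSeeds⁻ : ∀ {o} (ori : IsOrientation G o) {u r} → (u , r) ∈ₗ outSeeds ori →
    toℕ r < toℕ u × o u r ≡ true
  ∈-outSeeds⁻ {o} ori {u} {r} ur∈ = lowerOut⁻ o u r (roots⊆X (lowerCover ori u) r
    (to T-≡ (proj₂ (∈-filter⁻ (T? ∘ uncurry (lowerRoots ori)) {xs = allPairs} ur∈))))

  length-outSeeds : ∀ {o a} (ori : IsOrientation G o) → IsIndependenceNumber G a →
    length (outSeeds ori) ≤ n * a
  length-outSeeds {a = a} ori α =
    subst (λ k → length (outSeeds ori) ≤ k * a) (length-tabulate {n = n} (λ i → i))
      (length-filterᵇ-cartesianProduct≤ (uncurry (lowerRoots ori)) (allFin n) (allFin n) λ u →
        length-filterᵇ-independent≤ G α (lowerRoots ori u) (roots-independent (lowerCover ori u)))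

  seeds : ∀ {o} → IsOrientation G o → List (Fin n × Fin n)
  seeds ori = outSeeds ori ++ map swap (outSeeds (reverse-isOrientation ori))

  seeds-unique : ∀ {o} (ori : IsOrientation G o) → Unique (seeds ori)
  seeds-unique ori = Unique.++⁺ (unique ori) (Unique.map⁺ swap-injective (unique (reverse-isOrientation ori))) disjoint
    where
      unique : ∀ {o} (ori : IsOrientation G o) → Unique (outSeeds ori)
      unique ori = Unique.filter⁺ (T? ∘ uncurry (lowerRoots ori))
        (Unique.cartesianProduct⁺ (Unique.allFin⁺ n) (Unique.allFin⁺ n))
      swap-injective : ∀ {x y : Fin n × Fin n} → swap x ≡ swap y → x ≡ y
      swap-injective {_ , _} {_ , _} refl = refl
      disjoint : ∀ {e} → ¬ (e ∈ₗ outSeeds ori × e ∈ₗ map swap (outSeeds (reverse-isOrientation ori)))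
      disjoint (e∈ , e∈′) with ∈-map⁻ swap e∈′
      ... | _ , e′∈ , refl = <-asym (proj₁ (∈-outSeeds⁻ ori e∈)) (proj₁ (∈-outSeeds⁻ (reverse-isOrientation ori) e′∈))

  seeds-contained : ∀ {o} (ori : IsOrientation G o) → Contains o (seeds ori)
  seeds-contained ori e∈ with ∈-++⁻ (outSeeds ori) e∈
  ... | inj₁ e∈₁ = proj₂ (∈-outSeeds⁻ ori e∈₁)
  ... | inj₂ e∈₂ with ∈-map⁻ swap e∈₂
  ...   | _ , e′∈ , refl = proj₂ (∈-outSeeds⁻ (reverse-isOrientation ori) e′∈)

  length-seeds : ∀ {o a} (ori : IsOrientation G o) → IsIndependenceNumber G a →
    length (seeds ori) ≤ 2 * n * a
  length-seeds {a = a} ori α = begin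
    length (outSeeds ori ++ swapped)          ≡⟨ length-++ (outSeeds ori) ⟩
    length (outSeeds ori) + length swapped    ≤⟨ +-mono-≤ (length-outSeeds ori α) (begin
      length swapped                            ≡⟨ length-map swap (outSeeds (reverse-isOrientation ori)) ⟩
      length (outSeeds (reverse-isOrientation ori)) ≤⟨ length-outSeeds (reverse-isOrientation ori) α ⟩
      n * a                                     ≤⟨ m≤m+n (n * a) 0 ⟩
      n * a + 0                                 ∎) ⟩
    n * a + (n * a + 0)                       ≡⟨ ≡.sym (*-assoc 2 n a) ⟩
    2 * n * a                                 ∎
    where
      open ≤-Reasoning
      swapped = map swap (outSeeds (reverse-isOrientation ori))

  AgreeBelow : Digraph n → Digraph n → ℕ → Set
  AgreeBelow o o′ m = ∀ x w → toℕ x < m → toℕ w < m → o x w ≡ true → o′ x w ≡ true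

  reverse-agreeBelow : ∀ {o o′ m} → AgreeBelow o o′ m → AgreeBelow (reverse o) (reverse o′) m
  reverse-agreeBelow agree x w x<m w<m = agree w x w<m x<m

  lowerOut-forced : ∀ {o o′} (ori : IsOrientation G o) → IsOrientation G o′ → C3Free o′ → ∀ u →
    AgreeBelow o o′ (toℕ u) → (∀ r → lowerRoots ori u r ≡ true → o′ u r ≡ true) →
    ∀ v → toℕ v < toℕ u → o u v ≡ true → o′ u v ≡ true
  lowerOut-forced {o} {o′} ori ori′ c3′ u agree roots⇒o′ v v<u ouv =
    reachable⇒arc roots⇒o′ lower⇒o′ total c3′ (reaches (lowerCover ori u) v (∈-allFin v) (lowerOut⁺ {o} v<u ouv))
    where
      lower⇒o′ : ∀ x w → lowerOut o u x ≡ true → lowerOut o u w ≡ true → o x w ≡ true → o′ x w ≡ true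
      lower⇒o′ x w x∈ w∈ = agree x w (proj₁ (lowerOut⁻ o u x x∈)) (proj₁ (lowerOut⁻ o u w w∈))
      total : ∀ w → lowerOut o u w ≡ true → (o′ u w ≡ true) ⊎ (o′ w u ≡ true)
      total w w∈ = IsOrientation.edge⇒arc ori′ u w (IsOrientation.arc⇒edge ori u w (proj₂ (lowerOut⁻ o u w w∈)))

  agreeBelow-suc : ∀ {o o′ m} (ori : IsOrientation G o) → IsC3FreeOrientation G o′ →
    Contains o′ (seeds ori) → AgreeBelow o o′ m → AgreeBelow o o′ (suc m)
  agreeBelow-suc {o} {o′} ori (ori′ , c3′) S⊆o′ agree x w x<1+m w<1+m oxw
    with m<1+n⇒m<n∨m≡n x<1+m | m<1+n⇒m<n∨m≡n w<1+m
  ... | inj₁ x<m  | inj₁ w<m = agree x w x<m w<m oxw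
  ... | inj₂ refl | inj₁ w<x =
    lowerOut-forced ori ori′ c3′ x agree (λ r xr → S⊆o′ (∈-++⁺ˡ (∈-outSeeds⁺ ori xr))) w w<x oxw
  ... | inj₁ x<w  | inj₂ refl =
    lowerOut-forced (reverse-isOrientation ori) (reverse-isOrientation ori′) (reverse-C3Free c3′) w
      (reverse-agreeBelow agree)
      (λ r wr → S⊆o′ (∈-++⁺ʳ (outSeeds ori) (∈-map⁺ swap (∈-outSeeds⁺ (reverse-isOrientation ori) wr))))
      x x<w oxw
  ... | inj₂ refl | inj₂ w≡x =
    ⊥-elim (orientation-irreflexive ori x (subst (λ y → o x y ≡ true) (toℕ-injective w≡x) oxw))

  seeds-force : ∀ {o o′} (ori : IsOrientation G o) → IsC3FreeOrientation G o′ →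
    Contains o′ (seeds ori) → ∀ u v → o′ u v ≡ o u v
  seeds-force {o} {o′} ori c3ori′ S⊆o′ =
    orientation-⊆⇒≡ ori (proj₁ c3ori′) λ u v → agreeBelow n u v (toℕ<n u) (toℕ<n v)
    where
      agreeBelow : ∀ m → AgreeBelow o o′ m
      agreeBelow zero    _ _ ()
      agreeBelow (suc m) = agreeBelow-suc ori c3ori′ S⊆o′ (agreeBelow m)

open Seeds

lemma3p2 : (n : ℕ) (G : Graph n) (o : Digraph n) (a : ℕ) →
    IsIndependenceNumber G a →
    IsC3FreeOrientation G o →
    Σ (List (Fin n × Fin n)) λ S →
      Unique S × Contains o S × length S ≤ 2 * n * a ×
      (∀ (o′ : Digraph n) → IsC3FreeOrientation G o′ → Contains o′ S →
         ∀ u v → o′ u v ≡ o u v)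
lemma3p2 n G o a α (ori , _) =
  seeds G ori , seeds-unique G ori , seeds-contained G ori , length-seeds G ori α ,
  λ o′ c3ori′ S⊆o′ → seeds-force G ori c3ori′ S⊆o′
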